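{- Consider SINGLE-REF with parameters $t \in \{k+1,\dots,n-k\}$ and $r \in \{1,\dots,k\}$. Let $i \in \{1,\dots,k-r\}$ and $j \in \{1,\dots,i\}$. Then $p_{r+i}^{(j)} = p_{r+i}^{(i+1)}$, where $p_{m}^{(\ell)}$ denotes the probability that SINGLE-REF accepts item $v_m$ as its $\ell$-th accepted item.
   Context: $k$-secretary problem: $n$ items with distinct values $v_1 > \dots > v_n$ arrive in a uniformly random order (all $n!$ permutations equally likely); at most $k$ may be accepted, each decision immediately and irrevocably on arrival. SINGLE-REF with parameters $t$ and $r$: reject the first $t-1$ items; let $s_r$ be the $r$-th best among them; then accept the first $k$ items that are better than $s_r$. -}

module Defs where

open import Data.Nat using (ℕ; zero; suc; _+_; _∸_; _<ᵇ_; _≡ᵇ_; _!)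
open import Data.Nat.Properties using (_!≢0)
open import Data.Bool using (Bool; true; false; if_then_else_)
open import Data.List using (List; []; _∷_; map; concatMap; take; drop; upTo; length)
open import Data.Maybe using (Maybe; just; nothing)
open import Data.Integer using (+_)
open import Data.Rational using (ℚ; _/_)

-- Items are identified with their rank: item m (1 ≤ m ≤ n) is v_m,
-- so a SMALLER number means a BETTER (more valuable) item.

insertEverywhere : {A : Set} → A → List A → List (List A)
insertEverywhere x [] = (x ∷ []) ∷ []
insertEverywhere x (y ∷ ys) = (x ∷ y ∷ ys) ∷ map (y ∷_) (insertEverywhere x ys)

perms : {A : Set} → List A → List (List A)
perms [] = [] ∷ []
perms (x ∷ xs) = concatMap (insertEverywhere x) (perms xs)

items : ℕ → List ℕ
items n = map suc (upTo n)

-- all n! arrival orders (first element of the list arrives first)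
arrivalOrders : ℕ → List (List ℕ)
arrivalOrders n = perms (items n)

insertSorted : ℕ → List ℕ → List ℕ
insertSorted x [] = x ∷ []
insertSorted x (y ∷ ys) = if x <ᵇ y then x ∷ y ∷ ys else y ∷ insertSorted x ys

sortBest : List ℕ → List ℕ
sortBest [] = []
sortBest (x ∷ xs) = insertSorted x (sortBest xs)

at : ℕ → List ℕ → Maybe ℕ
at _ [] = nothing
at zero (x ∷ xs) = just x
at (suc i) (x ∷ xs) = at i xs

acceptBetter : ℕ → ℕ → List ℕ → List ℕ
acceptBetter s zero xs = []
acceptBetter s (suc k) [] = []
acceptBetter s (suc k) (x ∷ xs) =
  if x <ᵇ s then x ∷ acceptBetter s k xs else acceptBetter s (suc k) xs

singleRef : (k t r : ℕ) → List ℕ → List ℕ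
singleRef k t r σ with at (r ∸ 1) (sortBest (take (t ∸ 1) σ))
... | nothing = []   -- s_r undefined (never happens when 1 ≤ r ≤ t-1)
... | just s = acceptBetter s k (drop (t ∸ 1) σ)

acceptsAs : (k t r m ℓ : ℕ) → List ℕ → Bool
acceptsAs k t r m ℓ σ with at (ℓ ∸ 1) (singleRef k t r σ)
... | nothing = false
... | just x = x ≡ᵇ m

countTrue : {A : Set} → (A → Bool) → List A → ℕ
countTrue p [] = 0
countTrue p (x ∷ xs) = if p x then suc (countTrue p xs) else countTrue p xs

prob : (n k t r m ℓ : ℕ) → ℚ
prob n k t r m ℓ =
  ((+ countTrue (acceptsAs k t r m ℓ) (arrivalOrders n)) / (n !)) {{n !≢0}}

-- The reference s_r depends only on the first t − 1 arrivals, and SINGLE-REF accepts the first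
-- k later arrivals that beat s_r. Exchanging the positions of the j-th and the (i+1)-th of these
-- later arrivals better than s_r (when the latter exists) is an involution on arrival orders that
-- fixes s_r and moves v_{r+i} from acceptance slot j to slot i + 1. If v_{r+i} beats s_r, the
-- (i+1)-th such arrival does exist: at least r + i items beat s_r, and at most r − 1 of them are
-- among the first t − 1 arrivals. As all arrival orders are equally likely, the involution
-- makes the two probabilities equal.

module Submission where

open import Defs
open import Data.Bool using (Bool; true; false; T; not; if_then_else_)
open import Data.Empty using (⊥-elim)
open import Data.Integer using (+_)
open import Data.Rational using (_/_)
open import Data.List using (List; []; _∷_; _++_; [_]; map; concatMap; take; drop; length; filterᵇ; applyUpTo)
open import Data.List.Properties using (∷-injective; filter-accept; take++drop≡id; map-upTo; applyUpTo-∷ʳ)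
open import Data.List.Membership.Propositional using (_∈_; _∉_)
open import Data.List.Membership.Propositional.Properties
  using (∈-∃++; ∈-map⁺; ∈-map⁻; ∈-concat⁺′; ∈-concat⁻′)
open import Data.List.Membership.Propositional.Properties.WithK using (unique∧set⇒bag)
open import Data.List.Relation.Binary.BagAndSetEquality using (∼bag⇒↭)
open import Data.List.Relation.Binary.Permutation.Propositional
  using (_↭_; ↭-refl; ↭-sym; ↭-trans; prep; swap; module PermutationReasoning)
open import Data.List.Relation.Binary.Permutation.Propositional.Properties
  using (shift; drop-∷; ∈-resp-↭; ++⁺ˡ; ++⁺ʳ; All-resp-↭; ↭-length; filter-↭)
open import Data.List.Relation.Unary.Any using (here; there)
open import Data.List.Relation.Unary.All using (All; []; _∷_)
import Data.List.Relation.Unary.All as All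
open import Data.List.Relation.Unary.All.Properties using (all-filter) renaming (map⁺ to All-map⁺)
open import Data.List.Relation.Unary.AllPairs using (AllPairs; []; _∷_)
open import Data.List.Relation.Unary.Unique.Propositional using (Unique)
import Data.List.Relation.Unary.Unique.Propositional.Properties as Unique
open import Data.Maybe using (Maybe; just; nothing; maybe′)
import Data.Maybe as Maybe
open import Data.Nat using (ℕ; zero; suc; _+_; _∸_; _≤_; _<_; _<ᵇ_; _≡ᵇ_; _!; z≤n; s≤s; s≤s⁻¹)
open import Data.Nat.Properties
open import Data.Product using (∃; _×_; _,_; proj₁; proj₂; uncurry)
import Data.Product as Product
open import Data.Sum using (inj₁; inj₂)
open import Function using (_∘_; id)
open import Function.Bundles using (mk⇔)
open import Relation.Nullary.Decidable using (T?)
open import Relation.Nullary.Reflects using (ofʸ; ofⁿ)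
open import Relation.Binary.PropositionalEquality
  using (_≡_; refl; sym; trans; cong; cong₂; subst; module ≡-Reasoning)


countTrue≡length∘filterᵇ : {A : Set} (p : A → Bool) (xs : List A) →
  countTrue p xs ≡ length (filterᵇ p xs)
countTrue≡length∘filterᵇ p [] = refl
countTrue≡length∘filterᵇ p (x ∷ xs) with p x
... | true  = cong suc (countTrue≡length∘filterᵇ p xs)
... | false = countTrue≡length∘filterᵇ p xs

countTrue-↭ : {A : Set} (p : A → Bool) {xs ys : List A} → xs ↭ ys →
  countTrue p xs ≡ countTrue p ys
countTrue-↭ p {xs} {ys} xs↭ys = begin
  countTrue p xs         ≡⟨ countTrue≡length∘filterᵇ p xs ⟩
  length (filterᵇ p xs)  ≡⟨ ↭-length (filter-↭ (T? ∘ p) xs↭ys) ⟩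
  length (filterᵇ p ys)  ≡⟨ countTrue≡length∘filterᵇ p ys ⟨
  countTrue p ys         ∎
  where open ≡-Reasoning

countTrue-++ : {A : Set} (p : A → Bool) (xs ys : List A) →
  countTrue p (xs ++ ys) ≡ countTrue p xs + countTrue p ys
countTrue-++ p [] ys = refl
countTrue-++ p (x ∷ xs) ys with p x
... | true  = cong suc (countTrue-++ p xs ys)
... | false = countTrue-++ p xs ys

countTrue-map : {A B : Set} (p : B → Bool) (f : A → B) (xs : List A) →
  countTrue p (map f xs) ≡ countTrue (p ∘ f) xs
countTrue-map p f [] = refl
countTrue-map p f (x ∷ xs) with p (f x)
... | true  = cong suc (countTrue-map p f xs)
... | false = countTrue-map p f xs

countTrue-cong : {A : Set} (p q : A → Bool) (xs : List A) →
  (∀ {x} → x ∈ xs → p x ≡ q x) → countTrue p xs ≡ countTrue q xs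
countTrue-cong p q [] _ = refl
countTrue-cong p q (x ∷ xs) p≗q with p x | q x | p≗q (here refl)
... | true  | true  | _ = cong suc (countTrue-cong p q xs (p≗q ∘ there))
... | false | false | _ = countTrue-cong p q xs (p≗q ∘ there)

at-take : ∀ {q k} G → q < k → at q (take k G) ≡ at q G
at-take {_}     {suc k} []      _         = refl
at-take {zero}  {suc k} (x ∷ G) _         = refl
at-take {suc q} {suc k} (x ∷ G) (s≤s q<k) = at-take G q<k

at-All : ∀ {P : ℕ → Set} q {G y} → All P G → at q G ≡ just y → P y
at-All zero    (Py ∷ _)  refl = Py
at-All (suc q) (_ ∷ PG) e    = at-All q PG e

at≡nothing⇒length≤ : ∀ q G → at q G ≡ nothing → length G ≤ q
at≡nothing⇒length≤ q       []      _ = z≤n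
at≡nothing⇒length≤ (suc q) (x ∷ G) e = s≤s (at≡nothing⇒length≤ q G e)

-- Enumerating permutations

module _ {A B : Set} (g : A → List B) where

  ∈-concatMap⁻ : ∀ xs {y} → y ∈ concatMap g xs → ∃ λ x → x ∈ xs × y ∈ g x
  ∈-concatMap⁻ xs y∈ with ∈-concat⁻′ (map g xs) y∈
  ... | _ , y∈gx , gx∈ with ∈-map⁻ g gx∈
  ...   | x , x∈xs , refl = x , x∈xs , y∈gx

  ∈-concatMap⁺ : ∀ {xs x y} → x ∈ xs → y ∈ g x → y ∈ concatMap g xs
  ∈-concatMap⁺ x∈xs y∈gx = ∈-concat⁺′ y∈gx (∈-map⁺ g x∈xs)

  concatMap-unique : (xs : List A) → Unique xs → (∀ {x} → x ∈ xs → Unique (g x)) →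
    (∀ {x x′ y} → x ∈ xs → x′ ∈ xs → y ∈ g x → y ∈ g x′ → x ≡ x′) →
    Unique (concatMap g xs)
  concatMap-unique [] _ _ _ = []
  concatMap-unique (x ∷ xs) (x∉xs ∷ xs!) g! g-disjoint =
    Unique.++⁺ (g! (here refl))
      (concatMap-unique xs xs! (g! ∘ there) (λ a b → g-disjoint (there a) (there b)))
      λ (y∈gx , y∈rest) → let x′ , x′∈xs , y∈gx′ = ∈-concatMap⁻ xs y∈rest in
        All.lookup x∉xs x′∈xs (g-disjoint (here refl) (there x′∈xs) y∈gx y∈gx′)

module _ {A : Set} where

  ∈-insertEverywhere⁻ : ∀ (x : A) xs {σ} → σ ∈ insertEverywhere x xs → σ ↭ x ∷ xs
  ∈-insertEverywhere⁻ x []       (here refl) = ↭-refl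
  ∈-insertEverywhere⁻ x (y ∷ ys) (here refl) = ↭-refl
  ∈-insertEverywhere⁻ x (y ∷ ys) (there σ∈) with ∈-map⁻ (y ∷_) σ∈
  ... | τ , τ∈ , refl = ↭-trans (prep y (∈-insertEverywhere⁻ x ys τ∈)) (swap y x ↭-refl)

  ∈-insertEverywhere⁺ : ∀ (x : A) as bs → as ++ x ∷ bs ∈ insertEverywhere x (as ++ bs)
  ∈-insertEverywhere⁺ x []       []       = here refl
  ∈-insertEverywhere⁺ x []       (y ∷ bs) = here refl
  ∈-insertEverywhere⁺ x (y ∷ as) bs       = there (∈-map⁺ (y ∷_) (∈-insertEverywhere⁺ x as bs))

  ∈-perms⁻ : ∀ xs {σ : List A} → σ ∈ perms xs → σ ↭ xs
  ∈-perms⁻ []       (here refl) = ↭-refl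
  ∈-perms⁻ (x ∷ xs) σ∈ with ∈-concatMap⁻ (insertEverywhere x) (perms xs) σ∈
  ... | τ , τ∈ , σ∈ins = ↭-trans (∈-insertEverywhere⁻ x τ σ∈ins) (prep x (∈-perms⁻ xs τ∈))

  ∈-perms⁺ : ∀ xs {σ : List A} → σ ↭ xs → σ ∈ perms xs
  ∈-perms⁺ []       {[]}    _ = here refl
  ∈-perms⁺ []       {_ ∷ _} σ↭[] with () ← ∈-resp-↭ σ↭[] (here refl)
  ∈-perms⁺ (x ∷ xs) σ↭ with ∈-∃++ (∈-resp-↭ (↭-sym σ↭) (here refl))
  ... | as , bs , refl =
    ∈-concatMap⁺ (insertEverywhere x)
      (∈-perms⁺ xs (drop-∷ (↭-trans (↭-sym (shift x as bs)) σ↭)))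
      (∈-insertEverywhere⁺ x as bs)

  private
    head-of-∷-image : ∀ {x y : A} {zs} {L : List (List A)} → x ∷ zs ∈ map (y ∷_) L → x ≡ y
    head-of-∷-image {y = y} x∷zs∈ with ∈-map⁻ (y ∷_) x∷zs∈
    ... | _ , _ , refl = refl

  insertEverywhere-injective : ∀ {x : A} {xs ys σ} → x ∉ xs → x ∉ ys →
    σ ∈ insertEverywhere x xs → σ ∈ insertEverywhere x ys → xs ≡ ys
  insertEverywhere-injective {xs = []}    {[]}    _ _ _ _ = refl
  insertEverywhere-injective {xs = []}    {_ ∷ _} _ _ (here refl) (here ())
  insertEverywhere-injective {xs = []}    {_ ∷ _} _ x∉ys (here refl) (there σ∈) =
    ⊥-elim (x∉ys (here (head-of-∷-image σ∈)))
  insertEverywhere-injective {xs = _ ∷ _} {[]}    _ _ (here ()) (here refl)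
  insertEverywhere-injective {xs = _ ∷ _} {[]}    x∉xs _ (there σ∈) (here refl) =
    ⊥-elim (x∉xs (here (head-of-∷-image σ∈)))
  insertEverywhere-injective {xs = _ ∷ _} {_ ∷ _} _ _ (here refl) (here refl) = refl
  insertEverywhere-injective {xs = _ ∷ _} {_ ∷ _} _ x∉ys (here refl) (there σ∈) =
    ⊥-elim (x∉ys (here (head-of-∷-image σ∈)))
  insertEverywhere-injective {xs = _ ∷ _} {_ ∷ _} x∉xs _ (there σ∈) (here refl) =
    ⊥-elim (x∉xs (here (head-of-∷-image σ∈)))
  insertEverywhere-injective {xs = y ∷ _} {_ ∷ _} x∉xs x∉ys (there σ∈) (there σ∈′)
    with ∈-map⁻ (y ∷_) σ∈ | ∈-map⁻ (_ ∷_) σ∈′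
  ... | _ , τ∈ , refl | _ , τ∈′ , refl =
    cong (y ∷_) (insertEverywhere-injective (x∉xs ∘ there) (x∉ys ∘ there) τ∈ τ∈′)

  insertEverywhere-unique : ∀ (x : A) xs → x ∉ xs → Unique (insertEverywhere x xs)
  insertEverywhere-unique x []       _    = [] ∷ []
  insertEverywhere-unique x (y ∷ ys) x∉xs =
    All-map⁺ (All.tabulate λ _ e → x∉xs (here (proj₁ (∷-injective e))))
    ∷ Unique.map⁺ (proj₂ ∘ ∷-injective) (insertEverywhere-unique x ys (x∉xs ∘ there))

  perms-unique : ∀ (xs : List A) → Unique xs → Unique (perms xs)
  perms-unique []       _            = [] ∷ []
  perms-unique (x ∷ xs) (x∉xs ∷ xs!) =
    concatMap-unique (insertEverywhere x) (perms xs) (perms-unique xs xs!)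
      (λ τ∈ → insertEverywhere-unique x _ (x∉ τ∈))
      (λ τ∈ τ′∈ → insertEverywhere-injective (x∉ τ∈) (x∉ τ′∈))
    where
    x∉ : ∀ {τ} → τ ∈ perms xs → x ∉ τ
    x∉ τ∈ x∈τ = All.lookup x∉xs (∈-resp-↭ (∈-perms⁻ xs τ∈) x∈τ) refl

  -- map f (perms xs) and perms xs are duplicate-free with the same elements, hence bag-equal.
  countTrue-perms-involution : (xs : List A) → Unique xs → (f : List A → List A) →
    (∀ σ → f (f σ) ≡ σ) → (∀ σ → f σ ↭ σ) → (p : List A → Bool) →
    countTrue (p ∘ f) (perms xs) ≡ countTrue p (perms xs)
  countTrue-perms-involution xs xs! f f∘f≡id f-↭ p = begin
    countTrue (p ∘ f) (perms xs)  ≡⟨ countTrue-map p f (perms xs) ⟨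
    countTrue p (map f (perms xs))
      ≡⟨ countTrue-↭ p (∼bag⇒↭ (unique∧set⇒bag f-perms! perms! (mk⇔ to from))) ⟩
    countTrue p (perms xs)        ∎
    where
    open ≡-Reasoning
    perms! : Unique (perms xs)
    perms! = perms-unique xs xs!
    f-injective : ∀ {σ τ} → f σ ≡ f τ → σ ≡ τ
    f-injective {σ} {τ} e = trans (sym (f∘f≡id σ)) (trans (cong f e) (f∘f≡id τ))
    f-perms! : Unique (map f (perms xs))
    f-perms! = Unique.map⁺ f-injective perms!
    to : ∀ {σ} → σ ∈ map f (perms xs) → σ ∈ perms xs
    to σ∈ with ∈-map⁻ f σ∈
    ... | τ , τ∈ , refl = ∈-perms⁺ xs (↭-trans (f-↭ τ) (∈-perms⁻ xs τ∈))
    from : ∀ {σ} → σ ∈ perms xs → σ ∈ map f (perms xs)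
    from {σ} σ∈ = subst (_∈ map f (perms xs)) (f∘f≡id σ)
      (∈-map⁺ f (∈-perms⁺ xs (↭-trans (f-↭ σ) (∈-perms⁻ xs σ∈))))

-- Insertion sort and counting the items better than a given one

betterThan : ℕ → ℕ → Bool
betterThan s y = y <ᵇ s

insertSorted-↭ : ∀ x ys → insertSorted x ys ↭ x ∷ ys
insertSorted-↭ x [] = ↭-refl
insertSorted-↭ x (y ∷ ys) with x <ᵇ y
... | true  = ↭-refl
... | false = ↭-trans (prep y (insertSorted-↭ x ys)) (swap y x ↭-refl)

sortBest-↭ : ∀ xs → sortBest xs ↭ xs
sortBest-↭ []       = ↭-refl
sortBest-↭ (x ∷ xs) = ↭-trans (insertSorted-↭ x (sortBest xs)) (prep x (sortBest-↭ xs))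

insertSorted-sorted : ∀ x {ys} → AllPairs _≤_ ys → AllPairs _≤_ (insertSorted x ys)
insertSorted-sorted x {[]}     [] = [] ∷ []
insertSorted-sorted x {y ∷ ys} (y≤ys ∷ ys↑) with x <ᵇ y | <ᵇ-reflects-< x y
... | true  | ofʸ x<y = (<⇒≤ x<y ∷ All.map (≤-trans (<⇒≤ x<y)) y≤ys) ∷ y≤ys ∷ ys↑
... | false | ofⁿ x≮y =
  All-resp-↭ (↭-sym (insertSorted-↭ x ys)) (≮⇒≥ x≮y ∷ y≤ys) ∷ insertSorted-sorted x ys↑

sortBest-sorted : ∀ xs → AllPairs _≤_ (sortBest xs)
sortBest-sorted []       = []
sortBest-sorted (x ∷ xs) = insertSorted-sorted x (sortBest-sorted xs)

countTrue-betterThan-≥ : ∀ {s ys} → All (s ≤_) ys → countTrue (betterThan s) ys ≡ 0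
countTrue-betterThan-≥ [] = refl
countTrue-betterThan-≥ {s} {y ∷ _} (s≤y ∷ s≤ys) with y <ᵇ s | <ᵇ-reflects-< y s
... | true  | ofʸ y<s = ⊥-elim (≤⇒≯ s≤y y<s)
... | false | _       = countTrue-betterThan-≥ s≤ys

countTrue-betterThan-sorted : ∀ q {ys s} → AllPairs _≤_ ys → at q ys ≡ just s →
  countTrue (betterThan s) ys ≤ q
countTrue-betterThan-sorted zero    {y ∷ ys} (y≤ys ∷ _) refl with y <ᵇ y | <ᵇ-reflects-< y y
... | true  | ofʸ y<y = ⊥-elim (<-irrefl refl y<y)
... | false | _       = ≤-reflexive (countTrue-betterThan-≥ y≤ys)
countTrue-betterThan-sorted (suc q) {y ∷ ys} {s} (_ ∷ ys↑) ys[q]≡s with y <ᵇ s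
... | true  = s≤s (countTrue-betterThan-sorted q ys↑ ys[q]≡s)
... | false = m≤n⇒m≤1+n (countTrue-betterThan-sorted q ys↑ ys[q]≡s)

countTrue-betterThan-sortBest : ∀ q xs {s} → at q (sortBest xs) ≡ just s →
  countTrue (betterThan s) xs ≤ q
countTrue-betterThan-sortBest q xs {s} e =
  subst (_≤ q) (countTrue-↭ (betterThan s) (sortBest-↭ xs))
    (countTrue-betterThan-sorted q (sortBest-sorted xs) e)

countTrue-applyUpTo-suc : (p : ℕ → Bool) (n : ℕ) →
  countTrue p (applyUpTo suc (suc n)) ≡ countTrue p (applyUpTo suc n) + countTrue p [ suc n ]
countTrue-applyUpTo-suc p n =
  trans (cong (countTrue p) (sym (applyUpTo-∷ʳ suc n))) (countTrue-++ p (applyUpTo suc n) [ suc n ])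

countTrue-betterThan-upTo : ∀ {s m} n → m ≤ n → m < s →
  m ≤ countTrue (betterThan s) (applyUpTo suc n)
countTrue-betterThan-upTo zero z≤n _ = z≤n
countTrue-betterThan-upTo {s} {m} (suc n) m≤1+n m<s
  rewrite countTrue-applyUpTo-suc (betterThan s) n with m≤n⇒m<n∨m≡n m≤1+n
... | inj₁ m<1+n = ≤-trans (countTrue-betterThan-upTo n (s≤s⁻¹ m<1+n) m<s) (m≤m+n _ _)
... | inj₂ refl with suc n <ᵇ s | <ᵇ-reflects-< (suc n) s
...   | true  | _         = subst (suc n ≤_) (+-comm 1 _)
                              (s≤s (countTrue-betterThan-upTo n ≤-refl (<-trans (n<1+n n) m<s)))
...   | false | ofⁿ ¬m<s = ⊥-elim (¬m<s m<s)

countTrue-betterThan-items : ∀ {s m} n → m ≤ n → m < s → m ≤ countTrue (betterThan s) (items n)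
countTrue-betterThan-items {s} n m≤n m<s =
  subst (λ xs → _ ≤ countTrue (betterThan s) xs) (sym (map-upTo suc n))
    (countTrue-betterThan-upTo n m≤n m<s)

-- Swapping two of the items selected by a predicate

module _ {A : Set} (p : A → Bool) where

  refill : List A → List A → List A
  refill []       _        = []
  refill (x ∷ xs) []       = x ∷ refill xs []
  refill (x ∷ xs) (y ∷ ys) = if p x then y ∷ refill xs ys else x ∷ refill xs (y ∷ ys)

  refill-filterᵇ : ∀ xs → refill xs (filterᵇ p xs) ≡ xs
  refill-filterᵇ [] = refl
  refill-filterᵇ (x ∷ xs) with p x in px
  ... | true rewrite px = cong (x ∷_) (refill-filterᵇ xs)
  ... | false with filterᵇ p xs | refill-filterᵇ xs
  ...   | []    | e = cong (x ∷_) e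
  ...   | _ ∷ _ | e rewrite px = cong (x ∷_) e

  filterᵇ-refill : ∀ xs {ys} → All (T ∘ p) ys → length ys ≡ countTrue p xs →
    filterᵇ p (refill xs ys) ≡ ys
  filterᵇ-refill []       []         _ = refl
  filterᵇ-refill (x ∷ xs) {[]}     _ |ys| with p x
  ... | false = filterᵇ-refill xs [] |ys|
  filterᵇ-refill (x ∷ xs) {y ∷ ys} (py ∷ pys) |ys| with p x in px
  ... | true  = trans (filter-accept (T? ∘ p) py)
                  (cong (y ∷_) (filterᵇ-refill xs pys (suc-injective |ys|)))
  ... | false rewrite px = filterᵇ-refill xs (py ∷ pys) |ys|

  refill-refill : ∀ xs {ys zs} → All (T ∘ p) ys →
    length ys ≡ countTrue p xs → length zs ≡ countTrue p xs →
    refill (refill xs ys) zs ≡ refill xs zs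
  refill-refill []       _ _ _ = refl
  refill-refill (x ∷ xs) {[]} {[]} _ |ys| _ with p x
  ... | false = cong (x ∷_) (refill-refill xs [] |ys| |ys|)
  refill-refill (x ∷ xs) {[]} {_ ∷ _} _ |ys| |zs| with () ← trans |ys| (sym |zs|)
  refill-refill (x ∷ xs) {_ ∷ _} {[]} _ |ys| |zs| with () ← trans |zs| (sym |ys|)
  refill-refill (x ∷ xs) {y ∷ ys} {z ∷ zs} (py ∷ pys) |ys| |zs| with p x in px
  ... | true with p y | py
  ...   | true | _ = cong (z ∷_) (refill-refill xs pys (suc-injective |ys|) (suc-injective |zs|))
  refill-refill (x ∷ xs) {y ∷ ys} {z ∷ zs} (py ∷ pys) |ys| |zs| | false rewrite px =
    cong (x ∷_) (refill-refill xs (py ∷ pys) |ys| |zs|)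

  refill-↭-++ : ∀ xs {ys} → length ys ≡ countTrue p xs → refill xs ys ↭ ys ++ filterᵇ (not ∘ p) xs
  refill-↭-++ []       {[]}    _ = ↭-refl
  refill-↭-++ (x ∷ xs) {[]}    |ys| with p x
  ... | false = prep x (refill-↭-++ xs |ys|)
  refill-↭-++ (x ∷ xs) {y ∷ ys} |ys| with p x
  ... | true  = prep y (refill-↭-++ xs (suc-injective |ys|))
  ... | false =
    ↭-trans (prep x (refill-↭-++ xs |ys|)) (↭-sym (shift x (y ∷ ys) _))

  refill-↭ : ∀ xs {ys} → ys ↭ filterᵇ p xs → refill xs ys ↭ xs
  refill-↭ xs {ys} ys↭ = begin
    refill xs ys                          ↭⟨ refill-↭-++ xs (trans (↭-length ys↭) |filter|) ⟩
    ys ++ filterᵇ (not ∘ p) xs            ↭⟨ ++⁺ʳ _ ys↭ ⟩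
    filterᵇ p xs ++ filterᵇ (not ∘ p) xs  ↭⟨ refill-↭-++ xs |filter| ⟨
    refill xs (filterᵇ p xs)              ≡⟨ refill-filterᵇ xs ⟩
    xs                                    ∎
    where
    open PermutationReasoning
    |filter| : length (filterᵇ p xs) ≡ countTrue p xs
    |filter| = sym (countTrue≡length∘filterᵇ p xs)

replaceAt : ℕ → ℕ → List ℕ → Maybe (ℕ × List ℕ)
replaceAt c       x []      = nothing
replaceAt zero    x (y ∷ G) = just (y , x ∷ G)
replaceAt (suc c) x (y ∷ G) = Maybe.map (Product.map₂ (y ∷_)) (replaceAt c x G)

replaceAt-at : ∀ c x G {y G′} → replaceAt c x G ≡ just (y , G′) → at c G ≡ just y
replaceAt-at zero    x (z ∷ G) refl = refl
replaceAt-at (suc c) x (z ∷ G) e with replaceAt c x G in e′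
replaceAt-at (suc c) x (z ∷ G) refl | just _ = replaceAt-at c x G e′

replaceAt-replaceAt : ∀ c x G {y G′} → replaceAt c x G ≡ just (y , G′) → replaceAt c y G′ ≡ just (x , G)
replaceAt-replaceAt zero    x (z ∷ G) refl = refl
replaceAt-replaceAt (suc c) x (z ∷ G) e with replaceAt c x G in e′
replaceAt-replaceAt (suc c) x (z ∷ G) refl | just _
  rewrite replaceAt-replaceAt c x G e′ = refl

replaceAt-↭ : ∀ c x G {y G′} → replaceAt c x G ≡ just (y , G′) → y ∷ G′ ↭ x ∷ G
replaceAt-↭ zero    x (z ∷ G) refl = swap z x ↭-refl
replaceAt-↭ (suc c) x (z ∷ G) e with replaceAt c x G in e′
replaceAt-↭ (suc c) x (z ∷ G) refl | just (w , H) =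
  ↭-trans (swap w z ↭-refl) (↭-trans (prep z (replaceAt-↭ c x G e′)) (swap z x ↭-refl))

replaceAt≡nothing : ∀ c x G → replaceAt c x G ≡ nothing → at c G ≡ nothing
replaceAt≡nothing c       x []      _ = refl
replaceAt≡nothing (suc c) x (y ∷ G) e with replaceAt c x G in e′
... | nothing = replaceAt≡nothing c x G e′

at≡nothing : ∀ c x G → at c G ≡ nothing → replaceAt c x G ≡ nothing
at≡nothing c       x []      _ = refl
at≡nothing (suc c) x (y ∷ G) e rewrite at≡nothing c x G e = refl

swapAt : ℕ → ℕ → List ℕ → List ℕ
swapAt zero    (suc b) (x ∷ G) = maybe′ (uncurry _∷_) (x ∷ G) (replaceAt b x G)
swapAt (suc a) (suc b) (x ∷ G) = x ∷ swapAt a b G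
swapAt _       _       G       = G

swapAt-↭ : ∀ {a b} G → a < b → swapAt a b G ↭ G
swapAt-↭ {zero}  {suc b} []      _         = ↭-refl
swapAt-↭ {suc a} {suc b} []      _         = ↭-refl
swapAt-↭ {zero}  {suc b} (x ∷ G) _ with replaceAt b x G in e
... | nothing       = ↭-refl
... | just (y , G′) = replaceAt-↭ b x G e
swapAt-↭ {suc a} {suc b} (x ∷ G) (s≤s a<b) = prep x (swapAt-↭ G a<b)

swapAt-involutive : ∀ {a b} G → a < b → swapAt a b (swapAt a b G) ≡ G
swapAt-involutive {zero}  {suc b} []      _ = refl
swapAt-involutive {suc a} {suc b} []      _ = refl
swapAt-involutive {zero}  {suc b} (x ∷ G) _ with replaceAt b x G in e
... | nothing rewrite e = refl
... | just (y , G′) rewrite replaceAt-replaceAt b x G e = refl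
swapAt-involutive {suc a} {suc b} (x ∷ G) (s≤s a<b) = cong (x ∷_) (swapAt-involutive G a<b)

at-swapAt : ∀ {a b z} G → a < b → at b G ≡ just z → at b (swapAt a b G) ≡ at a G
at-swapAt {zero}  {suc b} (x ∷ G) _ G[b]≡z with replaceAt b x G in e
... | nothing with () ← trans (sym G[b]≡z) (replaceAt≡nothing b x G e)
... | just (y , G′) = replaceAt-at b y G′ (replaceAt-replaceAt b x G e)
at-swapAt {suc a} {suc b} (x ∷ G) (s≤s a<b) G[b]≡z = at-swapAt G a<b G[b]≡z

swapAt-outOfRange : ∀ {a b} G → a < b → at b G ≡ nothing → swapAt a b G ≡ G
swapAt-outOfRange {zero}  {suc b} []      _ _ = refl
swapAt-outOfRange {suc a} {suc b} []      _ _ = refl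
swapAt-outOfRange {zero}  {suc b} (x ∷ G) _ G[b]≡∅ rewrite at≡nothing b x G G[b]≡∅ = refl
swapAt-outOfRange {suc a} {suc b} (x ∷ G) (s≤s a<b) G[b]≡∅ = cong (x ∷_) (swapAt-outOfRange G a<b G[b]≡∅)

swapFiltered : (ℕ → Bool) → ℕ → ℕ → List ℕ → List ℕ
swapFiltered p a b xs = refill p xs (swapAt a b (filterᵇ p xs))

module _ (p : ℕ → Bool) {a b : ℕ} (a<b : a < b) where

  private
    swapped-↭ : ∀ xs → swapAt a b (filterᵇ p xs) ↭ filterᵇ p xs
    swapped-↭ xs = swapAt-↭ (filterᵇ p xs) a<b

    swapped-length : ∀ xs → length (swapAt a b (filterᵇ p xs)) ≡ countTrue p xs
    swapped-length xs = trans (↭-length (swapped-↭ xs)) (sym (countTrue≡length∘filterᵇ p xs))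

    swapped-All : ∀ xs → All (T ∘ p) (swapAt a b (filterᵇ p xs))
    swapped-All xs = All-resp-↭ (↭-sym (swapped-↭ xs)) (all-filter (T? ∘ p) xs)

  filterᵇ-swapFiltered : ∀ xs → filterᵇ p (swapFiltered p a b xs) ≡ swapAt a b (filterᵇ p xs)
  filterᵇ-swapFiltered xs = filterᵇ-refill p xs (swapped-All xs) (swapped-length xs)

  swapFiltered-involutive : ∀ xs → swapFiltered p a b (swapFiltered p a b xs) ≡ xs
  swapFiltered-involutive xs = begin
    refill p (swapFiltered p a b xs) (swapAt a b (filterᵇ p (swapFiltered p a b xs)))
      ≡⟨ cong (refill p (swapFiltered p a b xs) ∘ swapAt a b) (filterᵇ-swapFiltered xs) ⟩
    refill p (swapFiltered p a b xs) (swapAt a b (swapAt a b (filterᵇ p xs)))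
      ≡⟨ cong (refill p (swapFiltered p a b xs)) (swapAt-involutive (filterᵇ p xs) a<b) ⟩
    refill p (refill p xs (swapAt a b (filterᵇ p xs))) (filterᵇ p xs)
      ≡⟨ refill-refill p xs (swapped-All xs) (swapped-length xs) (sym (countTrue≡length∘filterᵇ p xs)) ⟩
    refill p xs (filterᵇ p xs)
      ≡⟨ refill-filterᵇ p xs ⟩
    xs ∎
    where open ≡-Reasoning

  swapFiltered-↭ : ∀ xs → swapFiltered p a b xs ↭ xs
  swapFiltered-↭ xs = refill-↭ p xs (swapped-↭ xs)

take-drop-take-++ : {A : Set} (n : ℕ) (σ : List A) {ys : List A} → (drop n σ ≡ [] → ys ≡ []) →
  take n (take n σ ++ ys) ≡ take n σ × drop n (take n σ ++ ys) ≡ ys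
take-drop-take-++ zero    σ       _     = refl , refl
take-drop-take-++ (suc n) []      ys≡[] rewrite ys≡[] refl = refl , refl
take-drop-take-++ (suc n) (x ∷ σ) ys≡[] = Product.map₁ (cong (x ∷_)) (take-drop-take-++ n σ ys≡[])

module _ {A : Set} (m : ℕ) (g : List A → List A → List A) where

  actOnSuffix : List A → List A
  actOnSuffix σ = take m σ ++ g (take m σ) (drop m σ)

  module _ (g-[] : ∀ π → g π [] ≡ []) where

    private
      prefix-suffix : ∀ σ →
        take m (actOnSuffix σ) ≡ take m σ × drop m (actOnSuffix σ) ≡ g (take m σ) (drop m σ)
      prefix-suffix σ = take-drop-take-++ m σ (λ e → trans (cong (g (take m σ)) e) (g-[] (take m σ)))

    take-actOnSuffix : ∀ σ → take m (actOnSuffix σ) ≡ take m σ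
    take-actOnSuffix σ = proj₁ (prefix-suffix σ)

    drop-actOnSuffix : ∀ σ → drop m (actOnSuffix σ) ≡ g (take m σ) (drop m σ)
    drop-actOnSuffix σ = proj₂ (prefix-suffix σ)

    actOnSuffix-involutive : (∀ π d → g π (g π d) ≡ d) → ∀ σ → actOnSuffix (actOnSuffix σ) ≡ σ
    actOnSuffix-involutive g-involutive σ = begin
      take m (actOnSuffix σ) ++ g (take m (actOnSuffix σ)) (drop m (actOnSuffix σ))
        ≡⟨ cong₂ (λ π d → π ++ g π d) (take-actOnSuffix σ) (drop-actOnSuffix σ) ⟩
      take m σ ++ g (take m σ) (g (take m σ) (drop m σ))
        ≡⟨ cong (take m σ ++_) (g-involutive (take m σ) (drop m σ)) ⟩
      take m σ ++ drop m σ
        ≡⟨ take++drop≡id m σ ⟩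
      σ ∎
      where open ≡-Reasoning

  actOnSuffix-↭ : (∀ π d → g π d ↭ d) → ∀ σ → actOnSuffix σ ↭ σ
  actOnSuffix-↭ g-↭ σ =
    subst (actOnSuffix σ ↭_) (take++drop≡id m σ) (++⁺ˡ (take m σ) (g-↭ (take m σ) (drop m σ)))

-- SINGLE-REF

rthBest : ℕ → List ℕ → Maybe ℕ
rthBest r π = at (r ∸ 1) (sortBest π)

reference : ℕ → ℕ → List ℕ → Maybe ℕ
reference t r σ = rthBest r (take (t ∸ 1) σ)

infix 4 _is_
_is_ : Maybe ℕ → ℕ → Bool
nothing is m = false
just x  is m = x ≡ᵇ m

acceptBetter≡take∘filterᵇ : ∀ s k xs → acceptBetter s k xs ≡ take k (filterᵇ (betterThan s) xs)
acceptBetter≡take∘filterᵇ s zero    xs       = refl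
acceptBetter≡take∘filterᵇ s (suc k) []       = refl
acceptBetter≡take∘filterᵇ s (suc k) (x ∷ xs) with x <ᵇ s
... | true  = cong (x ∷_) (acceptBetter≡take∘filterᵇ s k xs)
... | false = acceptBetter≡take∘filterᵇ s (suc k) xs

acceptsAs≡is : ∀ k t r m ℓ σ → acceptsAs k t r m ℓ σ ≡ (at (ℓ ∸ 1) (singleRef k t r σ) is m)
acceptsAs≡is k t r m ℓ σ with at (ℓ ∸ 1) (singleRef k t r σ)
... | nothing = refl
... | just _  = refl

acceptsAs-noReference : ∀ k t r m ℓ σ → reference t r σ ≡ nothing → acceptsAs k t r m ℓ σ ≡ false
acceptsAs-noReference k t r m ℓ σ e rewrite acceptsAs≡is k t r m ℓ σ | e = refl

acceptsAs-reference : ∀ k t r m ℓ σ {s} → reference t r σ ≡ just s → ℓ ∸ 1 < k →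
  acceptsAs k t r m ℓ σ ≡ (at (ℓ ∸ 1) (filterᵇ (betterThan s) (drop (t ∸ 1) σ)) is m)
acceptsAs-reference k t r m ℓ σ {s} e ℓ∸1<k
  rewrite acceptsAs≡is k t r m ℓ σ | e | acceptBetter≡take∘filterᵇ s k (drop (t ∸ 1) σ) =
  cong (_is m) (at-take _ ℓ∸1<k)

swapCandidates : (r a b : ℕ) → List ℕ → List ℕ → List ℕ
swapCandidates r a b π = maybe′ (λ s → swapFiltered (betterThan s) a b) id (rthBest r π)

swapAccepted : (t r a b : ℕ) → List ℕ → List ℕ
swapAccepted t r a b = actOnSuffix (t ∸ 1) (swapCandidates r a b)

module _ (t r a b : ℕ) where

  swapCandidates-[] : ∀ π → swapCandidates r a b π [] ≡ []
  swapCandidates-[] π with rthBest r π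
  ... | nothing = refl
  ... | just _  = refl

  reference-swapAccepted : ∀ σ → reference t r (swapAccepted t r a b σ) ≡ reference t r σ
  reference-swapAccepted σ =
    cong (rthBest r) (take-actOnSuffix (t ∸ 1) (swapCandidates r a b) swapCandidates-[] σ)

  drop-swapAccepted : ∀ {σ s} → reference t r σ ≡ just s →
    drop (t ∸ 1) (swapAccepted t r a b σ) ≡ swapFiltered (betterThan s) a b (drop (t ∸ 1) σ)
  drop-swapAccepted {σ} e =
    trans (drop-actOnSuffix (t ∸ 1) (swapCandidates r a b) swapCandidates-[] σ)
          (cong (λ ms → maybe′ (λ s → swapFiltered (betterThan s) a b) id ms (drop (t ∸ 1) σ)) e)

  module _ (a<b : a < b) where

    swapAccepted-involutive : ∀ σ → swapAccepted t r a b (swapAccepted t r a b σ) ≡ σ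
    swapAccepted-involutive =
      actOnSuffix-involutive (t ∸ 1) (swapCandidates r a b) swapCandidates-[] involutive
      where
      involutive : ∀ π d → swapCandidates r a b π (swapCandidates r a b π d) ≡ d
      involutive π d with rthBest r π
      ... | nothing = refl
      ... | just s  = swapFiltered-involutive (betterThan s) a<b d

    swapAccepted-↭ : ∀ σ → swapAccepted t r a b σ ↭ σ
    swapAccepted-↭ = actOnSuffix-↭ (t ∸ 1) (swapCandidates r a b) candidates-↭
      where
      candidates-↭ : ∀ π d → swapCandidates r a b π d ↭ d
      candidates-↭ π d with rthBest r π
      ... | nothing = ↭-refl
      ... | just s  = swapFiltered-↭ (betterThan s) a<b d

-- At least r + i items beat s_r, and at most r − 1 of them are among the first t − 1 arrivals.
countTrue-betterThan-suffix : ∀ {n t r i s σ} → σ ↭ items n → reference t r σ ≡ just s →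
  1 ≤ r → r + i ≤ n → r + i < s → suc i ≤ countTrue (betterThan s) (drop (t ∸ 1) σ)
countTrue-betterThan-suffix {n} {t} {suc r} {i} {s} {σ} σ↭ e _ r+i≤n r+i<s =
  +-cancelˡ-≤ r _ _ (begin
    r + suc i                          ≡⟨ +-suc r i ⟩
    suc r + i                          ≤⟨ countTrue-betterThan-items n r+i≤n r+i<s ⟩
    countTrue p (items n)              ≡⟨ countTrue-↭ p σ↭ ⟨
    countTrue p σ                      ≡⟨ cong (countTrue p) (take++drop≡id (t ∸ 1) σ) ⟨
    countTrue p (prefix ++ suffix)     ≡⟨ countTrue-++ p prefix suffix ⟩
    countTrue p prefix + countTrue p suffix
                                       ≤⟨ +-monoˡ-≤ _ (countTrue-betterThan-sortBest r prefix e) ⟩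
    r + countTrue p suffix             ∎)
  where
  open ≤-Reasoning
  p : ℕ → Bool
  p = betterThan s
  prefix suffix : List ℕ
  prefix = take (t ∸ 1) σ
  suffix = drop (t ∸ 1) σ

is≡true : ∀ mx m → (mx is m) ≡ true → mx ≡ just m
is≡true (just x) m e = cong just (≡ᵇ⇒≡ x m (subst T (sym e) _))

is-swapAt : ∀ {a b m} G → a < b → (at b G ≡ nothing → (at a G is m) ≡ false) →
  (at a G is m) ≡ (at b (swapAt a b G) is m)
is-swapAt {a} {b} {m} G a<b miss with at b G in G[b]
... | just _  = cong (_is m) (sym (at-swapAt G a<b G[b]))
... | nothing rewrite swapAt-outOfRange G a<b G[b] | G[b] = miss refl

absent-from-short-candidates : ∀ {n t r i s σ} q → σ ↭ items n → reference t r σ ≡ just s →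
  1 ≤ r → r + i ≤ n → at i (filterᵇ (betterThan s) (drop (t ∸ 1) σ)) ≡ nothing →
  (at q (filterᵇ (betterThan s) (drop (t ∸ 1) σ)) is r + i) ≡ false
absent-from-short-candidates {n} {t} {r} {i} {s} {σ} q σ↭ e 1≤r r+i≤n C[i]≡∅
  with at q (filterᵇ (betterThan s) (drop (t ∸ 1) σ)) is r + i in hit
... | false = refl
... | true  = ⊥-elim (≤⇒≯ (at≡nothing⇒length≤ i C C[i]≡∅)
                (subst (i <_) (countTrue≡length∘filterᵇ (betterThan s) (drop (t ∸ 1) σ))
                  (countTrue-betterThan-suffix {t = t} σ↭ e 1≤r r+i≤n r+i<s)))
  where
  C : List ℕ
  C = filterᵇ (betterThan s) (drop (t ∸ 1) σ)
  r+i<s : r + i < s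
  r+i<s = <ᵇ⇒< _ _ (at-All q (all-filter (T? ∘ betterThan s) (drop (t ∸ 1) σ)) (is≡true _ _ hit))

acceptsAs-swapAccepted : ∀ {n k t r i j σ} → σ ↭ items n →
  1 ≤ r → r + i ≤ n → j ∸ 1 < i → i < k →
  acceptsAs k t r (r + i) j σ ≡ acceptsAs k t r (r + i) (suc i) (swapAccepted t r (j ∸ 1) i σ)
acceptsAs-swapAccepted {n} {k} {t} {r} {i} {j} {σ} σ↭ 1≤r r+i≤n j∸1<i i<k =
  byReference (reference t r σ) refl
  where
  σ′ : List ℕ
  σ′ = swapAccepted t r (j ∸ 1) i σ
  same-reference : reference t r σ′ ≡ reference t r σ
  same-reference = reference-swapAccepted t r (j ∸ 1) i σ
  byReference : ∀ ms → reference t r σ ≡ ms →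
    acceptsAs k t r (r + i) j σ ≡ acceptsAs k t r (r + i) (suc i) σ′
  byReference nothing  e =
    trans (acceptsAs-noReference k t r (r + i) j σ e)
          (sym (acceptsAs-noReference k t r (r + i) (suc i) σ′ (trans same-reference e)))
  byReference (just s) e = begin
    acceptsAs k t r (r + i) j σ
      ≡⟨ acceptsAs-reference k t r (r + i) j σ e (<-trans j∸1<i i<k) ⟩
    (at (j ∸ 1) C is r + i)
      ≡⟨ is-swapAt C j∸1<i (absent-from-short-candidates {t = t} (j ∸ 1) σ↭ e 1≤r r+i≤n) ⟩
    (at i (swapAt (j ∸ 1) i C) is r + i)
      ≡⟨ cong (λ L → at i L is r + i) C′≡ ⟨
    (at i C′ is r + i)
      ≡⟨ acceptsAs-reference k t r (r + i) (suc i) σ′ (trans same-reference e) i<k ⟨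
    acceptsAs k t r (r + i) (suc i) σ′ ∎
    where
    open ≡-Reasoning
    C C′ : List ℕ
    C  = filterᵇ (betterThan s) (drop (t ∸ 1) σ)
    C′ = filterᵇ (betterThan s) (drop (t ∸ 1) σ′)
    C′≡ : C′ ≡ swapAt (j ∸ 1) i C
    C′≡ = trans (cong (filterᵇ (betterThan s)) (drop-swapAccepted t r (j ∸ 1) i e))
                (filterᵇ-swapFiltered (betterThan s) j∸1<i (drop (t ∸ 1) σ))

lemma8 : (n k t r i j : ℕ) →
    k + 1 ≤ t → t ≤ n ∸ k →
    1 ≤ r → r ≤ k →
    1 ≤ i → i ≤ k ∸ r →
    1 ≤ j → j ≤ i →
    prob n k t r (r + i) j ≡ prob n k t r (r + i) (suc i)
lemma8 n k t r i j k<t t≤n∸k 1≤r r≤k _ i≤k∸r 1≤j j≤i =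
  cong (λ c → ((+ c) / (n !)) {{n !≢0}}) (begin
    countTrue (acceptsAs k t r (r + i) j) (arrivalOrders n)
      ≡⟨ countTrue-cong _ _ (arrivalOrders n) (λ σ∈ →
           acceptsAs-swapAccepted {n} {k} {t} {r} {i} {j} (∈-perms⁻ (items n) σ∈) 1≤r r+i≤n j∸1<i i<k) ⟩
    countTrue (acceptsAs k t r (r + i) (suc i) ∘ swapAccepted t r (j ∸ 1) i) (arrivalOrders n)
      ≡⟨ countTrue-perms-involution (items n) items-unique (swapAccepted t r (j ∸ 1) i)
           (swapAccepted-involutive t r (j ∸ 1) i j∸1<i) (swapAccepted-↭ t r (j ∸ 1) i j∸1<i) _ ⟩
    countTrue (acceptsAs k t r (r + i) (suc i)) (arrivalOrders n) ∎)
  where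
  open ≡-Reasoning
  i+r≤k : i + r ≤ k
  i+r≤k = m≤o∸n⇒m+n≤o i r≤k i≤k∸r
  i<k : i < k
  i<k = <-≤-trans (m<m+n i 1≤r) i+r≤k
  k≤n : k ≤ n
  k≤n = ≤-trans (m≤m+n k 1) (≤-trans k<t (≤-trans t≤n∸k (m∸n≤m n k)))
  r+i≤n : r + i ≤ n
  r+i≤n = ≤-trans (≤-reflexive (+-comm r i)) (≤-trans i+r≤k k≤n)
  j∸1<i : j ∸ 1 < i
  j∸1<i = ∸-monoˡ-< (s≤s j≤i) 1≤j
  items-unique : Unique (items n)
  items-unique = Unique.map⁺ suc-injective (Unique.upTo⁺ n)
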